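{- Let $f:2^\omega\to\mathrm{Val}\to\mathrm{Val}$ be continuous in each variable (Cantor topology on $2^\omega$, Scott topology on $\mathrm{Val}$). Then for all $\alpha\in2^\omega$ and $b\in\mathrm{Val}$, $$f\alpha b=\bigcup_{c\in\mathcal P_{\mathrm{fin}}(b)}\ \bigcup_{x\prec\alpha}\ \bigcap_{\beta\in I_x}f\beta c.$$
   Context: $Q_0=\{\emptyset\}$, $Q_{n+1}=Q_n\uplus(2^*\times\mathcal P_{\mathrm{fin}}(Q_n)\times Q_n)$, $Q=\bigcup_nQ_n$, and $\mathrm{Val}=\mathcal P(Q)$ ordered by inclusion, with the Scott topology whose basic open sets are $\{b:a\subseteq b\}$ for finite $a\subseteq Q$; a map $\mathrm{Val}\to\mathrm{Val}$ is Scott-continuous iff $g(b)=\bigcup_{c\in\mathcal P_{\mathrm{fin}}(b)}g(c)$. $2^\omega$ is the Cantor space of infinite binary sequences; for a finite string $x$, $x\prec\alpha$ means $x$ is a prefix of $\alpha$, and $I_x=\{\beta\in2^\omega:x\prec\beta\}$. $\mathcal P_{\mathrm{fin}}(b)$ is the set of finite subsets of $b$. -}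

module Defs where

open import Data.Bool using (Bool)
open import Data.Nat using (ℕ; zero; suc)
open import Data.List using (List; []; _∷_)
open import Data.List.Membership.Propositional using (_∈_)
open import Data.Product using (Σ; _×_; _,_)
open import Relation.Binary.PropositionalEquality using (_≡_)

-- Q = ⋃ₙ Qₙ with Q₀ = {∅}, Qₙ₊₁ = Qₙ ⊎ (2* × P_fin(Qₙ) × Qₙ).
-- 2* = List Bool; finite subsets of Qₙ are represented by lists.
data Q : Set where
  ∅ : Q
  node : List Bool → List Q → Q → Q

Val : Set₁
Val = Q → Set

_⊆_ : Val → Val → Set
a ⊆ b = ∀ q → a q → b q

_≐_ : Val → Val → Set
a ≐ b = a ⊆ b × b ⊆ a

⟦_⟧ : List Q → Val
⟦ c ⟧ q = q ∈ c

FinSub : List Q → Val → Set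
FinSub c b = ⟦ c ⟧ ⊆ b

Cantor : Set
Cantor = ℕ → Bool

data _≺_ : List Bool → Cantor → Set where
  []≺ : ∀ {α} → [] ≺ α
  ∷≺  : ∀ {x α} → x ≺ (λ n → α (suc n)) → (α zero ∷ x) ≺ α

I : List Bool → Cantor → Set
I x β = x ≺ β

CantorOpen : (Cantor → Set) → Set
CantorOpen U = ∀ α → U α → Σ (List Bool) λ x → x ≺ α × (∀ β → I x β → U β)

ScottBasic : List Q → Val → Set
ScottBasic a b = ⟦ a ⟧ ⊆ b

CantorScottContinuous : (Cantor → Val) → Set
CantorScottContinuous h = ∀ (a : List Q) → CantorOpen (λ α → ScottBasic a (h α))

⋃fin : (Val → Val) → Val → Val
⋃fin g b q = Σ (List Q) λ c → FinSub c b × g ⟦ c ⟧ q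

ScottContinuous : (Val → Val) → Set₁
ScottContinuous g = ∀ b → g b ≐ ⋃fin g b

SepContinuous : (Cantor → Val → Val) → Set₁
SepContinuous f = (∀ α → ScottContinuous (f α)) × (∀ b → CantorScottContinuous (λ α → f α b))

RHS : (Cantor → Val → Val) → Cantor → Val → Val
RHS f α b q = Σ (List Q) λ c → FinSub c b ×
                Σ (List Bool) λ x → x ≺ α × (∀ β → I x β → f β ⟦ c ⟧ q)

module Submission where

-- Scott continuity in the second variable puts every q ∈ f α b already into some f α c with
-- c a finite part of b; continuity in the first variable, applied to the basic Scott-open
-- set of values containing q, then gives a cylinder I_x around α on which q ∈ f β c.
-- The reverse inclusion is the other half of Scott continuity, taking β = α.

open import Defs
open import Data.Bool using (Bool)
open import Data.List using (List; []; _∷_)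
open import Data.List.Relation.Unary.Any using (here)
open import Data.Product using (Σ; _×_; _,_; proj₁; proj₂)
open import Relation.Binary.PropositionalEquality using (refl)

singleton-⊆ : ∀ {a : Val} {q} → a q → ⟦ q ∷ [] ⟧ ⊆ a
singleton-⊆ aq _ (here refl) = aq

member-persistsOnCylinder : {h : Cantor → Val} → CantorScottContinuous h →
  ∀ {α q} → h α q → Σ (List Bool) λ x → x ≺ α × (∀ β → I x β → h β q)
member-persistsOnCylinder cont {α} {q} hαq with cont (q ∷ []) α (singleton-⊆ hαq)
... | x , x≺α , near = x , x≺α , λ β β∈Ix → near β β∈Ix q (here refl)

f⊆RHS : (f : Cantor → Val → Val) → SepContinuous f → ∀ α b → f α b ⊆ RHS f α b
f⊆RHS f (scott , cantor) α b q q∈fαb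
  with proj₁ (scott α b) q q∈fαb
... | c , c⊆b , q∈fαc = c , c⊆b , member-persistsOnCylinder (cantor ⟦ c ⟧) q∈fαc

RHS⊆f : (f : Cantor → Val → Val) → SepContinuous f → ∀ α b → RHS f α b ⊆ f α b
RHS⊆f f (scott , _) α b q (c , c⊆b , x , x≺α , onCylinder) =
  proj₂ (scott α b) q (c , c⊆b , onCylinder α x≺α)

mainTheorem8 : (f : Cantor → Val → Val) → SepContinuous f →
    ∀ (α : Cantor) (b : Val) → f α b ≐ RHS f α b
mainTheorem8 f cont α b = f⊆RHS f cont α b , RHS⊆f f cont α b
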